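{- Let $\sigma\in\mathbb{N}\cup\{0\}$, $\theta\in\mathbb{N}$, let $G$ be a graph and let $X\subseteq V(G)$ be such that there is no $(\sigma,\theta)$-$X$-abyss in $G$. Then $G[X]$ admits a $2^\sigma$-vertex-coloring of $G$-diameter less than $\theta$.
   Context: Graphs are finite and simple; $\mathbb{N}$ is the positive integers. For a graph $F$, a vertex $a$ and $\rho\ge 0$, $N^\rho_F(a)$ is the set of vertices at distance exactly $\rho$ from $a$ in $F$. For $\sigma,\theta\ge 0$ and $X\subseteq V(G)$, a $(\sigma,\theta)$-$X$-abyss in $G$ is a tuple $(a_0,\dots,a_{\sigma+1})$ of vertices of $G$ such that: there is a connected induced subgraph $G_0$ of $G[X]$ with $a_0,\dots,a_{\sigma+1}\in V(G_0)$; for each $i\in\{0,\dots,\sigma-1\}$ there exist $\rho_i\in\mathbb{N}\cup\{0\}$ and a connected induced subgraph $G_{i+1}$ of $G[N^{\rho_i+1}_{G_i}(a_i)]$ with $a_{i+1},\dots,a_{\sigma+1}\in V(G_{i+1})$; and $\mathrm{dist}_G(a_\sigma,a_{\sigma+1})\ge\theta$. For $Y\subseteq V(G)$, $\mathrm{diam}_G(Y)=\max\{\mathrm{dist}_G(y,y'):y,y'\in Y\}$. For an induced subgraph $H$ of $G$, a $c$-vertex-coloring of $H$ is a tuple $(V_1,\dots,V_c)$ of pairwise disjoint (possibly empty) sets with union $V(H)$; it has $G$-diameter less than $h$ if for each $i$, every connected component $C$ of $H[V_i]$ satisfies $\mathrm{diam}_G(V(C))<h$. -}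

module Defs where

open import Data.Nat using (ℕ; zero; suc; _<_; _≤_)
open import Data.Fin using (Fin)
open import Data.Fin.Subset using (Subset; _∈_; _⊆_; ⊤)
open import Data.Bool using (Bool; true; false)
open import Data.Vec using (Vec; []; _∷_)
open import Data.Vec.Relation.Unary.All using (All)
open import Data.Product using (Σ; ∃; _×_; _,_)
open import Relation.Binary.PropositionalEquality using (_≡_)
open import Relation.Nullary using (¬_)

record Graph : Set where
  field
    n      : ℕ
    adj    : Fin n → Fin n → Bool
    sym    : ∀ u v → adj u v ≡ adj v u
    irrefl : ∀ v → adj v v ≡ false

open Graph public

Vtx : Graph → Set
Vtx G = Fin (n G)

VSet : Graph → Set
VSet G = Subset (n G)

data WalkIn (G : Graph) (S : VSet G) : Vtx G → Vtx G → ℕ → Set where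
  here : ∀ {u} → u ∈ S → WalkIn G S u u zero
  step : ∀ {u w v k} → u ∈ S → adj G u w ≡ true →
         WalkIn G S w v k → WalkIn G S u v (suc k)

DistIs : (G : Graph) → VSet G → Vtx G → Vtx G → ℕ → Set
DistIs G S u v ρ = WalkIn G S u v ρ × (∀ k → k < ρ → ¬ WalkIn G S u v k)

-- dist_G(u,v) ≥ θ   (true also when dist is infinite)
DistGe : (G : Graph) → Vtx G → Vtx G → ℕ → Set
DistGe G u v θ = ∀ k → k < θ → ¬ WalkIn G ⊤ u v k

DistLt : (G : Graph) → Vtx G → Vtx G → ℕ → Set
DistLt G u v h = Σ ℕ λ k → k < h × WalkIn G ⊤ u v k

Connected : (G : Graph) → VSet G → Set
Connected G S = ∀ u v → u ∈ S → v ∈ S → Σ ℕ λ k → WalkIn G S u v k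

⊆Sphere : (G : Graph) → VSet G → Vtx G → ℕ → VSet G → Set
⊆Sphere G S a ρ T = ∀ v → v ∈ T → v ∈ S × DistIs G S a v ρ

AllIn : (G : Graph) {m : ℕ} → Vec (Vtx G) m → VSet G → Set
AllIn G as S = All (λ v → v ∈ S) as

-- Nested part of an abyss: given current G_i (vertex set S) and (a_i, ..., a_{σ+1}).
Deep : (G : Graph) (θ : ℕ) (σ : ℕ) → VSet G → Vec (Vtx G) (suc (suc σ)) → Set
Deep G θ zero    S (x ∷ y ∷ []) = DistGe G x y θ
Deep G θ (suc σ) S (x ∷ rest)   =
  Σ ℕ λ ρ → Σ (VSet G) λ S' →
    ⊆Sphere G S x (suc ρ) S' × Connected G S' × AllIn G rest S' × Deep G θ σ S' rest

IsAbyss : (G : Graph) (σ θ : ℕ) (X : VSet G) → Vec (Vtx G) (suc (suc σ)) → Set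
IsAbyss G σ θ X as =
  Σ (VSet G) λ S₀ → S₀ ⊆ X × Connected G S₀ × AllIn G as S₀ × Deep G θ σ S₀ as

IsComponent : (G : Graph) → VSet G → VSet G → Set
IsComponent G Y C =
  C ⊆ Y × (Σ (Vtx G) λ v → v ∈ C) × Connected G C ×
  (∀ (S : VSet G) → C ⊆ S → S ⊆ Y → Connected G S → S ⊆ C)

IsColoring : (G : Graph) (X : VSet G) (c : ℕ) → (Fin c → VSet G) → Set
IsColoring G X c V =
  (∀ i j v → v ∈ V i → v ∈ V j → i ≡ j) ×
  (∀ v → v ∈ X → Σ (Fin c) λ i → v ∈ V i) ×
  (∀ i v → v ∈ V i → v ∈ X)

HasDiamLt : (G : Graph) (c : ℕ) → (Fin c → VSet G) → ℕ → Set
HasDiamLt G c V h =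
  ∀ i C → IsComponent G (V i) C → ∀ y y' → y ∈ C → y' ∈ C → DistLt G y y' h

-- Induction on σ, for the stronger property that every connected monochromatic subset of X (not
-- only every component of a colour class) has G-diameter < θ; the strengthening is needed because a
-- component of the new colouring is merely a connected subset of a class of a layer's colouring.
-- For σ = 0 this is the absence of a (0,θ)-abyss. For σ + 1, root each component of G[X] and split X
-- into layers by the distance to the root inside G[X]. Layer ρ + 1 of a component lies on the sphere
-- of radius ρ + 1 around its root, so a (σ,θ)-abyss inside it becomes a (σ+1,θ)-abyss once the root
-- is prepended; hence each layer is 2^σ-coloured by induction. Colour v by its layer's parity paired
-- with its colour inside the layer: adjacent vertices lie in equal or consecutive layers, so a
-- connected monochromatic set stays inside one layer, and in layer 0 (the roots) it is a single vertex.

module Submission where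

open import Defs renaming (sym to adj-sym)
open import Data.Nat using (ℕ; zero; suc; pred; _+_; _∸_; _^_; _≥_; _<_; _≤_; s≤s; _<?_)
import Data.Nat as ℕ
open import Data.Nat.Properties using (≮⇒≥; ≤-pred; n<1+n; m+[n∸m]≡n; +-monoˡ-<; anyUpTo?)
open import Data.Fin using (Fin; zero; suc; toℕ; combine; opposite; _≟_)
open import Data.Fin.Properties using (any?; pigeonhole; toℕ<n; opposite-involutive; combine-injectiveˡ; combine-injectiveʳ)
open import Data.Fin.Subset using (Subset; _∈_; _⊆_; ⊤)
open import Data.Fin.Subset.Properties using (_∈?_; ∈⊤)
open import Data.Bool using (true)
import Data.Bool as Bool
open import Data.List using (List; []; _∷_; filter; allFin)
import Data.List.Membership.Propositional as List
open import Data.List.Membership.Propositional.Properties using (∈-filter⁺; ∈-filter⁻; ∈-allFin)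
open import Data.List.Properties using (filter-≐)
open import Data.List.Relation.Unary.Any using (here; there)
open import Data.Vec using (Vec; []; _∷_; tabulate)
open import Data.Vec.Properties using (lookup⇒[]=; []=⇒lookup; lookup∘tabulate)
open import Data.Vec.Relation.Unary.All using ([]; _∷_)
import Data.Vec.Relation.Unary.All as All
open import Data.Product using (Σ; ∃; ∃-syntax; _×_; _,_; proj₁; proj₂)
open import Function using (_∘_)
open import Relation.Binary.PropositionalEquality using (_≡_; refl; sym; trans; cong; subst; subst₂; module ≡-Reasoning)
open import Relation.Nullary using (¬_; Dec; yes; no; does; contradiction)
open import Relation.Nullary.Decidable using (map′; _×-dec_; dec-true)
open import Relation.Unary using (Pred; Decidable; _≐_)

Least : ∀ {p} → Pred ℕ p → ℕ → Set p
Least P k = P k × (∀ j → j < k → ¬ P j)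

leastBelow : ∀ {p} {P : Pred ℕ p} → Decidable P → ℕ → ℕ
leastBelow P? zero = zero
leastBelow P? (suc b) with P? zero
... | yes _ = zero
... | no _ = suc (leastBelow (P? ∘ suc) b)

leastBelow-least : ∀ {p} {P : Pred ℕ p} (P? : Decidable P) {b k} → k < b → P k → Least P (leastBelow P? b)
leastBelow-least P? {suc b} k<b Pk with P? zero
... | yes P0 = P0 , λ _ ()
leastBelow-least P? {suc b} {zero} k<b P0 | no ¬P0 = contradiction P0 ¬P0
leastBelow-least P? {suc b} {suc k} (s≤s k<b) Pk | no ¬P0
  with P[1+l] , below ← leastBelow-least (P? ∘ suc) k<b Pk =
  P[1+l] , λ { zero _ → ¬P0 ; (suc j) (s≤s j<l) → below j j<l }

headOr : ∀ {a} {A : Set a} → A → List A → A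
headOr d []      = d
headOr _ (x ∷ _) = x

module _ {a} {A : Set a} {x : A} where

  headOr-∈ : ∀ {xs} d → x List.∈ xs → headOr d xs List.∈ xs
  headOr-∈ d (here _)  = here refl
  headOr-∈ d (there _) = here refl

  headOr-irrelevant : ∀ {xs} d d′ → x List.∈ xs → headOr d xs ≡ headOr d′ xs
  headOr-irrelevant d d′ (here _)  = refl
  headOr-irrelevant d d′ (there _) = refl

module _ {m p} {P : Pred (Fin m) p} (P? : Decidable P) where

  subsetOf : Subset m
  subsetOf = tabulate (does ∘ P?)

  ∈-subsetOf⁺ : ∀ {v} → P v → v ∈ subsetOf
  ∈-subsetOf⁺ {v} Pv = lookup⇒[]= v _ (trans (lookup∘tabulate _ v) (dec-true (P? v) Pv))

  ∈-subsetOf⁻ : ∀ {v} → v ∈ subsetOf → P v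
  ∈-subsetOf⁻ {v} v∈ with P? v | trans (sym (lookup∘tabulate (does ∘ P?) v)) ([]=⇒lookup v∈)
  ... | yes Pv | _ = Pv

opposite-injective : ∀ {n} {i j : Fin n} → opposite i ≡ opposite j → i ≡ j
opposite-injective {i = i} {j} eq =
  trans (sym (opposite-involutive i)) (trans (cong opposite eq) (opposite-involutive j))

parity : ℕ → Fin 2
parity zero    = zero
parity (suc k) = opposite (parity k)

parity-injective-on-neighbours : ∀ {m n} → m ≤ suc n → n ≤ suc m → parity m ≡ parity n → m ≡ n
parity-injective-on-neighbours {zero}        {zero}        _        _        _  = refl
parity-injective-on-neighbours {zero}        {suc zero}    _        _        ()
parity-injective-on-neighbours {zero}        {suc (suc _)} _        (s≤s ()) _
parity-injective-on-neighbours {suc zero}    {zero}        _        _        ()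
parity-injective-on-neighbours {suc (suc _)} {zero}        (s≤s ()) _        _
parity-injective-on-neighbours {suc m}       {suc n}       (s≤s m≤) (s≤s n≤) eq =
  cong suc (parity-injective-on-neighbours m≤ n≤ (opposite-injective eq))

module Walks (G : Graph) where

  private
    variable
      S T : VSet G
      u v w : Vtx G
      k l : ℕ

  head∈ : WalkIn G S u v k → u ∈ S
  head∈ (here u∈)     = u∈
  head∈ (step u∈ _ _) = u∈

  last∈ : WalkIn G S u v k → v ∈ S
  last∈ (here v∈)    = v∈
  last∈ (step _ _ p) = last∈ p

  zero-length : WalkIn G S u v 0 → u ≡ v
  zero-length (here _) = refl

  mono : S ⊆ T → WalkIn G S u v k → WalkIn G T u v k
  mono S⊆T (here u∈)     = here (S⊆T u∈)
  mono S⊆T (step u∈ e p) = step (S⊆T u∈) e (mono S⊆T p)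

  _++_ : WalkIn G S u v k → WalkIn G S v w l → WalkIn G S u w (k + l)
  here _     ++ q = q
  step u∈ e p ++ q = step u∈ e (p ++ q)

  _∷ʳ_ : WalkIn G S u v k → (adj G v w ≡ true) × w ∈ S → WalkIn G S u w (suc k)
  here v∈      ∷ʳ (e , w∈) = step v∈ e (here w∈)
  step u∈ e′ p ∷ʳ ew       = step u∈ e′ (p ∷ʳ ew)

  reverse : WalkIn G S u v k → WalkIn G S v u k
  reverse (here u∈)     = here u∈
  reverse (step u∈ e p) = reverse p ∷ʳ (trans (adj-sym G _ _) e , u∈)

  walk? : ∀ S u v k → Dec (WalkIn G S u v k)
  walk? S u v zero =
    map′ (λ { (u∈ , refl) → here u∈ }) (λ { (here u∈) → u∈ , refl })
         (u ∈? S ×-dec u ≟ v)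
  walk? S u v (suc k) =
    map′ (λ { (u∈ , w , e , p) → step u∈ e p }) (λ { (step u∈ e p) → u∈ , _ , e , p })
         (u ∈? S ×-dec any? (λ w → (adj G u w Bool.≟ true) ×-dec walk? S w v k))

  splitAt : WalkIn G S u v k → ∀ i → i ≤ k → ∃[ x ] WalkIn G S u x i × WalkIn G S x v (k ∸ i)
  splitAt p             zero    _         = _ , here (head∈ p) , p
  splitAt (step u∈ e p) (suc i) (s≤s i≤k) with x , p₁ , p₂ ← splitAt p i i≤k =
    x , step u∈ e p₁ , p₂

  vertexAt : WalkIn G S u v k → Fin (suc k) → Vtx G
  vertexAt p i = proj₁ (splitAt p (toℕ i) (≤-pred (toℕ<n i)))

  -- Pigeonhole: a walk with at least as many steps as vertices revisits a vertex; cut out the loop.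
  shortcut : WalkIn G S u v k → n G ≤ k → ∃[ j ] j < k × WalkIn G S u v j
  shortcut {S = S} {u} {v} {k} p n≤k with pigeonhole (s≤s n≤k) (vertexAt p)
  ... | i , j , i<j , same =
    _ , shorter , toᵢ ++ subst (λ x → WalkIn G S x v (k ∸ toℕ j)) (sym same) fromⱼ
    where
    j≤k : toℕ j ≤ k
    j≤k = ≤-pred (toℕ<n j)
    toᵢ : WalkIn G S u (vertexAt p i) (toℕ i)
    toᵢ = proj₁ (proj₂ (splitAt p (toℕ i) (≤-pred (toℕ<n i))))
    fromⱼ : WalkIn G S (vertexAt p j) v (k ∸ toℕ j)
    fromⱼ = proj₂ (proj₂ (splitAt p (toℕ j) j≤k))
    shorter : toℕ i + (k ∸ toℕ j) < k
    shorter = subst (toℕ i + (k ∸ toℕ j) <_) (m+[n∸m]≡n j≤k) (+-monoˡ-< (k ∸ toℕ j) i<j)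

  shortWalk : WalkIn G S u v k → ∃[ j ] j < n G × WalkIn G S u v j
  shortWalk {S = S} {u} {v} {k} p with leastBelow-least (walk? S u v) (n<1+n k) p
  ... | q , minimal with _ <? n G
  ...   | yes j<n = _ , j<n , q
  ...   | no j≮n with j , j<l , r ← shortcut q (≮⇒≥ j≮n) = contradiction r (minimal j j<l)

  Reachable : VSet G → Vtx G → Vtx G → Set
  Reachable S u v = ∃ (WalkIn G S u v)

  reachable? : ∀ S u v → Dec (Reachable S u v)
  reachable? S u v =
    map′ (λ (k , _ , p) → k , p) (λ (_ , p) → let (j , j<n , q) = shortWalk p in j , j<n , q)
         (anyUpTo? (walk? S u v) (n G))

module Layering (G : Graph) (X : VSet G) where

  open Walks G
  open ≡-Reasoning

  private
    variable
      u v w : Vtx G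
      k : ℕ

  reachableFrom : Vtx G → List (Vtx G)
  reachableFrom v = filter (reachable? X v) (allFin (n G))

  self∈reachableFrom : v ∈ X → v List.∈ reachableFrom v
  self∈reachableFrom {v} v∈X = ∈-filter⁺ (reachable? X v) (∈-allFin v) (0 , here v∈X)

  -- Any choice depending only on the component of v in G[X] would do.
  root : Vtx G → Vtx G
  root v = headOr v (reachableFrom v)

  root-reachable : v ∈ X → Reachable X v (root v)
  root-reachable {v} v∈X =
    proj₂ (∈-filter⁻ (reachable? X v) {xs = allFin (n G)} (headOr-∈ v (self∈reachableFrom v∈X)))

  root-adjacent : u ∈ X → w ∈ X → adj G u w ≡ true → root u ≡ root w
  root-adjacent {u} {w} u∈X w∈X e = begin
    headOr u (reachableFrom u) ≡⟨ headOr-irrelevant u w (self∈reachableFrom u∈X) ⟩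
    headOr w (reachableFrom u) ≡⟨ cong (headOr w) (filter-≐ (reachable? X u) (reachable? X w) same (allFin (n G))) ⟩
    headOr w (reachableFrom w) ∎
    where
    same : Reachable X u ≐ Reachable X w
    same = (λ (_ , p) → _ , step w∈X (trans (adj-sym G w u) e) p) , (λ (_ , p) → _ , step u∈X e p)

  root-walk : WalkIn G X u w k → root u ≡ root w
  root-walk (here _)      = refl
  root-walk (step u∈ e p) = trans (root-adjacent u∈ (head∈ p) e) (root-walk p)

  root∈ : v ∈ X → root v ∈ X
  root∈ v∈X = last∈ (proj₂ (root-reachable v∈X))

  root-idempotent : v ∈ X → root (root v) ≡ root v
  root-idempotent v∈X = sym (root-walk (proj₂ (root-reachable v∈X)))

  InComponent : Vtx G → Vtx G → Set
  InComponent r v = v ∈ X × root v ≡ r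

  inComponent? : ∀ r v → Dec (InComponent r v)
  inComponent? r v = v ∈? X ×-dec root v ≟ r

  component : Vtx G → VSet G
  component r = subsetOf (inComponent? r)

  component⊆X : ∀ {r} → component r ⊆ X
  component⊆X {r} m = proj₁ (∈-subsetOf⁻ (inComponent? r) m)

  ∈component : v ∈ X → v ∈ component (root v)
  ∈component {v} v∈X = ∈-subsetOf⁺ (inComponent? (root v)) (v∈X , refl)

  walk-in-component : WalkIn G X u w k → WalkIn G (component (root u)) u w k
  walk-in-component (here u∈)     = here (∈component u∈)
  walk-in-component (step u∈ e p) =
    step (∈component u∈) e
         (subst (λ r → WalkIn G (component r) _ _ _) (sym (root-adjacent u∈ (head∈ p) e)) (walk-in-component p))

  component-reaches-root : ∀ {r} → v ∈ component r → Reachable (component r) v r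
  component-reaches-root {r = r} v∈ with v∈X , refl ← ∈-subsetOf⁻ (inComponent? r) v∈ =
    _ , walk-in-component (proj₂ (root-reachable v∈X))

  component-connected : ∀ r → Connected G (component r)
  component-connected r u v u∈ v∈
    with _ , p ← component-reaches-root u∈ | _ , q ← component-reaches-root v∈ = _ , p ++ reverse q

  depth : Vtx G → ℕ
  depth v = leastBelow (walk? X v (root v)) (n G)

  depth-least : v ∈ X → Least (WalkIn G X v (root v)) (depth v)
  depth-least {v} v∈X with _ , p ← root-reachable v∈X with _ , j<n , q ← shortWalk p =
    leastBelow-least (walk? X v (root v)) j<n q

  depth-adjacent : u ∈ X → w ∈ X → adj G u w ≡ true → depth u ≤ suc (depth w)
  depth-adjacent {u} {w} u∈X w∈X e = ≮⇒≥ λ shorter → proj₂ (depth-least u∈X) _ shorter via-w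
    where
    via-w : WalkIn G X u (root u) (suc (depth w))
    via-w = subst (λ r → WalkIn G X u r _) (sym (root-adjacent u∈X w∈X e))
                  (step u∈X e (proj₁ (depth-least w∈X)))

  depth-zero : v ∈ X → depth v ≡ 0 → root v ≡ v
  depth-zero {v} v∈X eq = sym (zero-length (subst (WalkIn G X v (root v)) eq (proj₁ (depth-least v∈X))))

  depth-distance : v ∈ X → DistIs G (component (root v)) (root v) v (depth v)
  depth-distance v∈X with p , minimal ← depth-least v∈X =
    reverse (walk-in-component p) , λ k k<d q → minimal k k<d (reverse (mono component⊆X q))

  depth-constant : ∀ {S p} → S ⊆ X → (∀ {v} → v ∈ S → parity (depth v) ≡ p) →
                   WalkIn G S u w k → depth u ≡ depth w
  depth-constant S⊆X same-parity (here _)      = refl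
  depth-constant S⊆X same-parity (step u∈ e q) = trans first-step (depth-constant S⊆X same-parity q)
    where
    first-step : depth _ ≡ depth _
    first-step = parity-injective-on-neighbours
      (depth-adjacent (S⊆X u∈) (S⊆X (head∈ q)) e)
      (depth-adjacent (S⊆X (head∈ q)) (S⊆X u∈) (trans (adj-sym G _ _) e))
      (trans (same-parity u∈) (sym (same-parity (head∈ q))))

MonochromaticDiamLt : (G : Graph) → VSet G → ∀ {c} → (Vtx G → Fin c) → ℕ → Set
MonochromaticDiamLt G X f h =
  ∀ i S → S ⊆ X → Connected G S → (∀ {v} → v ∈ S → f v ≡ i) →
  ∀ {y y′} → y ∈ S → y′ ∈ S → DistLt G y y′ h

Abyss : (G : Graph) → ℕ → ℕ → VSet G → Set
Abyss G σ θ X = Σ (Vec (Vtx G) (suc (suc σ))) (IsAbyss G σ θ X)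

noAbyss₀⇒diamLt : ∀ {G θ X S} → ¬ Abyss G 0 θ X → S ⊆ X → Connected G S →
                  ∀ {y y′} → y ∈ S → y′ ∈ S → DistLt G y y′ θ
noAbyss₀⇒diamLt {G} {θ} {X} {S} noAbyss S⊆X S-conn {y} {y′} y∈ y′∈
  with anyUpTo? (Walks.walk? G ⊤ y y′) θ
... | yes close = close
... | no far    = contradiction abyss noAbyss
  where
  abyss : Abyss G 0 θ X
  abyss = y ∷ y′ ∷ [] , S , (λ {v} → S⊆X {v}) , S-conn , y∈ ∷ y′∈ ∷ [] ,
          λ k k<θ p → far (k , k<θ , p)

module LayerColouring
  (G : Graph) {σ θ} (θ≥1 : θ ≥ 1) (X : VSet G) (noAbyss : ¬ Abyss G (suc σ) θ X)
  (colouring : ∀ Y → ¬ Abyss G σ θ Y → Σ (Vtx G → Fin (2 ^ σ)) λ f → MonochromaticDiamLt G Y f θ)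
  where

  open Walks G
  open Layering G X
  open ≡-Reasoning

  private
    variable
      v : Vtx G

  InLayer : ℕ → Vtx G → Set
  InLayer ρ v = v ∈ X × depth v ≡ ρ

  inLayer? : ∀ ρ v → Dec (InLayer ρ v)
  inLayer? ρ v = v ∈? X ×-dec depth v ℕ.≟ ρ

  layer : ℕ → VSet G
  layer ρ = subsetOf (inLayer? ρ)

  abyss-extend : ∀ {ρ a as} → IsAbyss G σ θ (layer (suc ρ)) (a ∷ as) →
                 IsAbyss G (suc σ) θ X (root a ∷ a ∷ as)
  abyss-extend {ρ} {a} (S , S⊆layer , S-conn , all∈S , deep) =
    component (root a) , component⊆X , component-connected (root a) ,
    root∈component ∷ All.map S⊆component all∈S ,
    ρ , S , sphere , S-conn , all∈S , deep
    where
    inLayer : v ∈ S → InLayer (suc ρ) v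
    inLayer = ∈-subsetOf⁻ (inLayer? (suc ρ)) ∘ S⊆layer
    a∈S : a ∈ S
    a∈S = All.head all∈S
    S⊆X : S ⊆ X
    S⊆X = proj₁ ∘ inLayer
    a∈X : a ∈ X
    a∈X = S⊆X a∈S
    same-root : v ∈ S → root v ≡ root a
    same-root {v} v∈ = sym (root-walk (mono S⊆X (proj₂ (S-conn a v a∈S v∈))))
    S⊆component : S ⊆ component (root a)
    S⊆component v∈ = subst (λ r → _ ∈ component r) (same-root v∈) (∈component (S⊆X v∈))
    root∈component : root a ∈ component (root a)
    root∈component = subst (λ r → root a ∈ component r) (root-idempotent a∈X)
                           (∈component (root∈ a∈X))
    sphere : ⊆Sphere G (component (root a)) (root a) (suc ρ) S
    sphere v v∈ = S⊆component v∈ ,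
      subst₂ (λ r d → DistIs G (component r) r v d) (same-root v∈) (proj₂ (inLayer v∈))
             (depth-distance (S⊆X v∈))

  layerColouring : ∀ ρ → Σ (Vtx G → Fin (2 ^ σ)) λ f → MonochromaticDiamLt G (layer (suc ρ)) f θ
  layerColouring ρ = colouring (layer (suc ρ)) λ { (a ∷ as , abyss) → noAbyss (_ , abyss-extend abyss) }

  -- As pred 0 = 0, layer 0 (the roots) borrows the colouring of layer 1.
  colour : Vtx G → Fin (2 ^ suc σ)
  colour v = combine (parity (depth v)) (proj₁ (layerColouring (pred (depth v))) v)

  colour-on-layer : ∀ {ρ} → depth v ≡ suc ρ →
                    colour v ≡ combine (parity (suc ρ)) (proj₁ (layerColouring ρ) v)
  colour-on-layer {v} eq rewrite eq = refl

  colour-diamLt : MonochromaticDiamLt G X colour θ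
  colour-diamLt i S S⊆X S-conn monochromatic {y} {y′} y∈ y′∈ = by-depth (depth y) refl
    where
    same-depth : v ∈ S → depth v ≡ depth y
    same-depth {v} v∈ = sym (depth-constant S⊆X same-parity (proj₂ (S-conn y v y∈ v∈)))
      where
      same-parity : ∀ {v} → v ∈ S → parity (depth v) ≡ parity (depth y)
      same-parity v∈ = combine-injectiveˡ _ _ _ _ (trans (monochromatic v∈) (sym (monochromatic y∈)))
    by-depth : ∀ d → depth y ≡ d → DistLt G y y′ θ
    by-depth zero    eq = 0 , θ≥1 , subst (λ z → WalkIn G ⊤ y z 0) y≡y′ (here ∈⊤)
      where
      y≡y′ : y ≡ y′
      y≡y′ = begin
        y       ≡⟨ sym (depth-zero (S⊆X y∈) eq) ⟩
        root y  ≡⟨ root-walk (mono S⊆X (proj₂ (S-conn y y′ y∈ y′∈))) ⟩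
        root y′ ≡⟨ depth-zero (S⊆X y′∈) (trans (same-depth y′∈) eq) ⟩
        y′      ∎
    by-depth (suc ρ) eq = proj₂ (layerColouring ρ) (f y) S S⊆layer S-conn same-layer-colour y∈ y′∈
      where
      on-layer : v ∈ S → depth v ≡ suc ρ
      on-layer v∈ = trans (same-depth v∈) eq
      S⊆layer : S ⊆ layer (suc ρ)
      S⊆layer v∈ = ∈-subsetOf⁺ (inLayer? (suc ρ)) (S⊆X v∈ , on-layer v∈)
      f : Vtx G → Fin (2 ^ σ)
      f = proj₁ (layerColouring ρ)
      same-layer-colour : v ∈ S → f v ≡ f y
      same-layer-colour {v} v∈ = combine-injectiveʳ (parity (suc ρ)) (f v) (parity (suc ρ)) (f y) (begin
        combine (parity (suc ρ)) (f v) ≡⟨ sym (colour-on-layer (on-layer v∈)) ⟩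
        colour v                       ≡⟨ trans (monochromatic v∈) (sym (monochromatic y∈)) ⟩
        colour y                       ≡⟨ colour-on-layer eq ⟩
        combine (parity (suc ρ)) (f y) ∎)

noAbyss⇒colouring : ∀ {θ} → θ ≥ 1 → (G : Graph) (σ : ℕ) (X : VSet G) → ¬ Abyss G σ θ X →
                    Σ (Vtx G → Fin (2 ^ σ)) λ f → MonochromaticDiamLt G X f θ
noAbyss⇒colouring θ≥1 G zero X noAbyss =
  (λ _ → zero) , λ _ S S⊆X S-conn _ → noAbyss₀⇒diamLt noAbyss S⊆X S-conn
noAbyss⇒colouring θ≥1 G (suc σ) X noAbyss = colour , colour-diamLt
  where open LayerColouring G θ≥1 X noAbyss (noAbyss⇒colouring θ≥1 G σ)

module _ (G : Graph) {c} (X : VSet G) (f : Vtx G → Fin c) where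

  InClass : Fin c → Vtx G → Set
  InClass i v = v ∈ X × f v ≡ i

  inClass? : ∀ i v → Dec (InClass i v)
  inClass? i v = v ∈? X ×-dec f v ≟ i

  classes : Fin c → VSet G
  classes i = subsetOf (inClass? i)

  classes-isColoring : IsColoring G X c classes
  classes-isColoring =
    (λ i j v v∈i v∈j → trans (sym (proj₂ (in-class v∈i))) (proj₂ (in-class v∈j))) ,
    (λ v v∈X → f v , ∈-subsetOf⁺ (inClass? (f v)) (v∈X , refl)) ,
    (λ i v v∈i → proj₁ (in-class v∈i))
    where
    in-class : ∀ {i v} → v ∈ classes i → InClass i v
    in-class {i} = ∈-subsetOf⁻ (inClass? i)

  classes-hasDiamLt : ∀ {h} → MonochromaticDiamLt G X f h → HasDiamLt G c classes h
  classes-hasDiamLt small i C (C⊆class , _ , C-conn , _) y y′ y∈ y′∈ =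
    small i C (λ v∈ → proj₁ (in-class v∈)) C-conn (λ v∈ → proj₂ (in-class v∈)) y∈ y′∈
    where
    in-class : ∀ {v} → v ∈ C → InClass i v
    in-class = ∈-subsetOf⁻ (inClass? i) ∘ C⊆class

lemma5p6 : (σ θ : ℕ) → θ ≥ 1 → (G : Graph) → (X : VSet G) →
    (¬ Σ (Vec (Vtx G) (suc (suc σ))) (λ as → IsAbyss G σ θ X as)) →
    Σ (Fin (2 ^ σ) → VSet G) (λ V → IsColoring G X (2 ^ σ) V × HasDiamLt G (2 ^ σ) V θ)
lemma5p6 σ θ θ≥1 G X noAbyss with f , small ← noAbyss⇒colouring θ≥1 G σ X noAbyss =
  classes G X f , classes-isColoring G X f , classes-hasDiamLt G X f small
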